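{- Let $S$ be a finite set of PLTL-clauses. Then (1) $Aug(S)$ is well-behaved, and (2) $Aug(S)$ has a model if and only if $S$ has a model.
   Context: PLTL formulae use the temporal operators $\bigcirc$ (next), $\Diamond$ (sometime), $\Box$ (always) interpreted over models $\sigma=s_0,s_1,\dots$ (infinite sequences of sets of proposition symbols): $(\sigma,i)\models p$ iff $p\in s_i$; $\bigcirc A$ at $i$ iff $A$ at $i+1$; $\Diamond A$ at $i$ iff $A$ at some $k\ge i$; $\Box A$ at $i$ iff $A$ at all $j\ge i$; Boolean connectives as usual; the nullary connective $\mathbf{start}$ holds exactly at index $0$. A literal is a proposition symbol or its negation. A PLTL-clause has one of the forms $\mathbf{start}\Rightarrow\bigvee_c l_c$ (initial), $\bigwedge_a k_a\Rightarrow\bigcirc\bigvee_d l_d$ (step), $\bigwedge_b k_b\Rightarrow\Diamond l$ (sometime), all $k,l$ literals. A set $\{A_i\}$ of clauses denotes $\Box\bigwedge_iA_i$; a model of the set is a $\sigma$ with $(\sigma,0)\models\Box\bigwedge_iA_i$. The literal $l$ of a sometime clause is an eventuality literal. For a conjunction of literals $C$, $\neg C$ is the disjunction of complementary literals. $Aug(S)$: for each eventuality literal $l$ of $S$ introduce a new proposition symbol $w_l$ and add the clause $w_l\Rightarrow\bigcirc(l\vee w_l)$; for each sometime clause $C\Rightarrow\Diamond l$ of $S$ add $\mathbf{start}\Rightarrow\neg C\vee l\vee w_l$ and $\mathbf{true}\Rightarrow\bigcirc(\neg C\vee l\vee w_l)$. A normal model of $Aug(S)$ is a model of it satisfying $\Box(w_l\Leftrightarrow(\neg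 l\wedge\Diamond l))$ for every eventuality literal $l$ of $S$. An augmented clause set is well-behaved if it is either unsatisfiable or has a normal model. -}

module Defs where

open import Data.Nat using (ℕ; zero; suc; _≤_)
open import Data.Bool using (Bool; true; false)
open import Data.List using (List; []; _∷_; map; _++_; concatMap)
open import Data.List.Relation.Unary.All using (All)
open import Data.List.Relation.Unary.Any using (Any)
open import Data.List.Membership.Propositional using (_∈_)
open import Data.Product using (Σ; ∃; _×_; _,_)
open import Data.Sum using (_⊎_; inj₁; inj₂)
open import Relation.Binary.PropositionalEquality using (_≡_)
open import Relation.Nullary using (¬_)
open import Function.Bundles using (_⇔_)

data Lit (A : Set) : Set where
  pos : A → Lit A
  neg : A → Lit A

comp : {A : Set} → Lit A → Lit A
comp (pos a) = neg a
comp (neg a) = pos a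

-- ¬C for a conjunction C of literals: disjunction of complements.
negConj : {A : Set} → List (Lit A) → List (Lit A)
negConj C = map comp C

-- PLTL-clauses.
--   initial D    :  start ⇒ ⋁ D
--   step C D     :  ⋀ C ⇒ ○ ⋁ D
--   sometime C l :  ⋀ C ⇒ ◇ l
data Clause (A : Set) : Set where
  initial  : List (Lit A) → Clause A
  step     : List (Lit A) → List (Lit A) → Clause A
  sometime : List (Lit A) → Lit A → Clause A

-- A model: an infinite sequence of sets of proposition symbols,
-- each set given by its characteristic function.
Seq : Set → Set
Seq A = ℕ → A → Bool

LitHolds : {A : Set} → Seq A → ℕ → Lit A → Set
LitHolds σ i (pos a) = σ i a ≡ true
LitHolds σ i (neg a) = σ i a ≡ false

ConjHolds : {A : Set} → Seq A → ℕ → List (Lit A) → Set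
ConjHolds σ i C = All (LitHolds σ i) C

DisjHolds : {A : Set} → Seq A → ℕ → List (Lit A) → Set
DisjHolds σ i D = Any (LitHolds σ i) D

ClauseHolds : {A : Set} → Seq A → ℕ → Clause A → Set
ClauseHolds σ i (initial D)    = i ≡ 0 → DisjHolds σ i D
ClauseHolds σ i (step C D)     = ConjHolds σ i C → DisjHolds σ (suc i) D
ClauseHolds σ i (sometime C l) = ConjHolds σ i C → Σ ℕ (λ k → i ≤ k × LitHolds σ k l)

-- σ is a model of the clause set S, i.e. (σ , 0) ⊨ □ ⋀ S.
IsModel : {A : Set} → Seq A → List (Clause A) → Set
IsModel σ S = (i : ℕ) → (c : Clause _) → c ∈ S → ClauseHolds σ i c

Satisfiable : {A : Set} → List (Clause A) → Set
Satisfiable {A} S = Σ (Seq A) (λ σ → IsModel σ S)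

-- Augmentation.  The symbols of Aug(S) are A ⊎ Lit A: inj₁ a is the
-- original symbol a, inj₂ l is the new (fresh) symbol w_l.

Aug⁺ : Set → Set
Aug⁺ A = A ⊎ Lit A

liftLit : {A : Set} → Lit A → Lit (Aug⁺ A)
liftLit (pos a) = pos (inj₁ a)
liftLit (neg a) = neg (inj₁ a)

liftLits : {A : Set} → List (Lit A) → List (Lit (Aug⁺ A))
liftLits = map liftLit

liftClause : {A : Set} → Clause A → Clause (Aug⁺ A)
liftClause (initial D)    = initial (liftLits D)
liftClause (step C D)     = step (liftLits C) (liftLits D)
liftClause (sometime C l) = sometime (liftLits C) (liftLit l)

w : {A : Set} → Lit A → Lit (Aug⁺ A)
w l = pos (inj₂ l)

-- clauses added for one clause of S (only sometime clauses add any):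
--   w_l ⇒ ○(l ∨ w_l),  start ⇒ ¬C ∨ l ∨ w_l,  true ⇒ ○(¬C ∨ l ∨ w_l)
-- (the first clause is added once per sometime clause with eventuality
-- literal l; duplicates are harmless since a clause list denotes a set)
augExtra : {A : Set} → Clause A → List (Clause (Aug⁺ A))
augExtra (initial D)    = []
augExtra (step C D)     = []
augExtra (sometime C l) =
    step (w l ∷ []) (liftLit l ∷ w l ∷ [])
  ∷ initial (negConj (liftLits C) ++ (liftLit l ∷ w l ∷ []))
  ∷ step [] (negConj (liftLits C) ++ (liftLit l ∷ w l ∷ []))
  ∷ []

Aug : {A : Set} → List (Clause A) → List (Clause (Aug⁺ A))
Aug S = map liftClause S ++ concatMap augExtra S

EventualityLit : {A : Set} → Lit A → List (Clause A) → Set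
EventualityLit {A} l S = Σ (List (Lit A)) (λ C → sometime C l ∈ S)

IsNormalModel : {A : Set} → List (Clause A) → Seq (Aug⁺ A) → Set
IsNormalModel {A} S σ =
  IsModel σ (Aug S) ×
  ((l : Lit A) → EventualityLit l S → (i : ℕ) →
     (LitHolds σ i (w l)
       ⇔ (LitHolds σ i (comp (liftLit l))
          × Σ ℕ (λ k → i ≤ k × LitHolds σ k (liftLit l)))))

WellBehaved : {A : Set} → List (Clause A) → Set
WellBehaved {A} S =
  ¬ Satisfiable (Aug S) ⊎ Σ (Seq (Aug⁺ A)) (λ σ → IsNormalModel S σ)

-- A model of Aug(S) restricts to a model of S, because Aug(S) contains every
-- clause of S verbatim.  Conversely, a model σ of S extends to a normal model
-- of Aug(S) by interpreting w_l as ¬l ∧ ◇l, which is decidable only by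
-- excluded middle.  With this reading, w_l ⇒ ○(l ∨ w_l) holds because an
-- outstanding eventuality is still outstanding or fulfilled at the next
-- instant, and ¬C ∨ l ∨ w_l holds because C ⇒ ◇l yields either l now or
-- ¬l ∧ ◇l.  Well-behavedness then follows by deciding whether S is
-- satisfiable.
module Submission where

open import Defs
open import Level using (0ℓ)
open import Axiom.ExcludedMiddle using (ExcludedMiddle)
open import Data.Bool using (true; false)
open import Data.Empty using (⊥)
open import Data.List using (List; []; _∷_; _++_; map)
open import Data.List.Membership.Propositional using (_∈_; find)
open import Data.List.Membership.Propositional.Properties
  using (∈-map⁺; ∈-map⁻; ∈-++⁺ˡ; ∈-++⁻; ∈-concatMap⁻)
open import Data.List.Relation.Unary.All as All using ([]; _∷_)
import Data.List.Relation.Unary.All.Properties as All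
open import Data.List.Relation.Unary.Any as Any using (here; there)
import Data.List.Relation.Unary.Any.Properties as Any
open import Data.Nat using (ℕ; suc; _≤_)
open import Data.Nat.Properties using (≤∧≢⇒<)
open import Data.Product using (Σ; _×_; _,_)
import Data.Product as Product
open import Data.Sum using (_⊎_; inj₁; inj₂)
open import Function using (_∘_)
open import Function.Bundles using (_⇔_; mk⇔; Equivalence)
open import Relation.Nullary using (yes; no; does; contradiction)
open import Relation.Binary.PropositionalEquality using (_≡_; refl; sym; trans; cong₂)

open Equivalence using (to; from)

module _ {A : Set} where

  Eventually : Seq A → ℕ → Lit A → Set
  Eventually σ i l = Σ ℕ (λ k → i ≤ k × LitHolds σ k l)

  Outstanding : Seq A → ℕ → Lit A → Set
  Outstanding σ i l = LitHolds σ i (comp l) × Eventually σ i l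

  lit-or-comp : ∀ σ i (l : Lit A) → LitHolds σ i l ⊎ LitHolds σ i (comp l)
  lit-or-comp σ i (pos a) with σ i a
  ... | true  = inj₁ refl
  ... | false = inj₂ refl
  lit-or-comp σ i (neg a) with σ i a
  ... | true  = inj₂ refl
  ... | false = inj₁ refl

  lit-comp-contradiction : ∀ σ i (l : Lit A) → LitHolds σ i l → LitHolds σ i (comp l) → ⊥
  lit-comp-contradiction σ i (pos a) l-holds comp-holds with () ← trans (sym l-holds) comp-holds
  lit-comp-contradiction σ i (neg a) l-holds comp-holds with () ← trans (sym comp-holds) l-holds

  conj-or-negConj : ∀ σ i (C : List (Lit A)) → ConjHolds σ i C ⊎ DisjHolds σ i (negConj C)
  conj-or-negConj σ i [] = inj₁ []
  conj-or-negConj σ i (l ∷ C) with lit-or-comp σ i l | conj-or-negConj σ i C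
  ... | inj₂ comp-l  | _            = inj₂ (here comp-l)
  ... | inj₁ l-holds | inj₁ C-holds = inj₁ (l-holds ∷ C-holds)
  ... | inj₁ _       | inj₂ ¬C      = inj₂ (there ¬C)

  eventually⇒now-or-outstanding : ∀ σ i (l : Lit A) →
    Eventually σ i l → LitHolds σ i l ⊎ Outstanding σ i l
  eventually⇒now-or-outstanding σ i l ev with lit-or-comp σ i l
  ... | inj₁ now    = inj₁ now
  ... | inj₂ comp-l = inj₂ (comp-l , ev)

  outstanding⇒eventually-next : ∀ σ i (l : Lit A) →
    Outstanding σ i l → Eventually σ (suc i) l
  outstanding⇒eventually-next σ i l (comp-l , k , i≤k , l-at-k) =
    k , ≤∧≢⇒< i≤k i≢k , l-at-k
    where
    i≢k : i ≡ k → ⊥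
    i≢k refl = lit-comp-contradiction σ i l l-at-k comp-l

restrict : {A : Set} → Seq (Aug⁺ A) → Seq A
restrict τ i a = τ i (inj₁ a)

comp-liftLit : {A : Set} (l : Lit A) → comp (liftLit l) ≡ liftLit (comp l)
comp-liftLit (pos a) = refl
comp-liftLit (neg a) = refl

negConj-liftLits : {A : Set} (C : List (Lit A)) → negConj (liftLits C) ≡ liftLits (negConj C)
negConj-liftLits []      = refl
negConj-liftLits (l ∷ C) = cong₂ _∷_ (comp-liftLit l) (negConj-liftLits C)

module _ {A : Set} (τ : Seq (Aug⁺ A)) where

  liftLit-holds : ∀ i (l : Lit A) → LitHolds τ i (liftLit l) ⇔ LitHolds (restrict τ) i l
  liftLit-holds i (pos a) = mk⇔ (λ h → h) (λ h → h)
  liftLit-holds i (neg a) = mk⇔ (λ h → h) (λ h → h)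

  liftLits-conj : ∀ i C → ConjHolds τ i (liftLits C) ⇔ ConjHolds (restrict τ) i C
  liftLits-conj i C = mk⇔ (All.gmap⁻ (liftLit-holds i _ .to))
                          (All.gmap⁺ (liftLit-holds i _ .from))

  liftLits-disj : ∀ i D → DisjHolds τ i (liftLits D) ⇔ DisjHolds (restrict τ) i D
  liftLits-disj i D = mk⇔ (Any.map (liftLit-holds i _ .to) ∘ Any.map⁻)
                          (Any.gmap (liftLit-holds i _ .from))

  liftLit-eventually : ∀ i l → Eventually τ i (liftLit l) ⇔ Eventually (restrict τ) i l
  liftLit-eventually i l =
    mk⇔ (Product.map₂ (Product.map₂ (liftLit-holds _ l .to)))
        (Product.map₂ (Product.map₂ (liftLit-holds _ l .from)))

  liftLit-outstanding : ∀ i l → Outstanding τ i (liftLit l) ⇔ Outstanding (restrict τ) i l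
  liftLit-outstanding i l rewrite comp-liftLit l =
    mk⇔ (Product.map (liftLit-holds i (comp l) .to) (liftLit-eventually i l .to))
        (Product.map (liftLit-holds i (comp l) .from) (liftLit-eventually i l .from))

  liftClause-holds : ∀ i c → ClauseHolds τ i (liftClause c) ⇔ ClauseHolds (restrict τ) i c
  liftClause-holds i (initial D) =
    mk⇔ (λ h → liftLits-disj i D .to ∘ h) (λ h → liftLits-disj i D .from ∘ h)
  liftClause-holds i (step C D) =
    mk⇔ (λ h → liftLits-disj (suc i) D .to ∘ h ∘ liftLits-conj i C .from)
        (λ h → liftLits-disj (suc i) D .from ∘ h ∘ liftLits-conj i C .to)
  liftClause-holds i (sometime C l) =
    mk⇔ (λ h → liftLit-eventually i l .to ∘ h ∘ liftLits-conj i C .from)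
        (λ h → liftLit-eventually i l .from ∘ h ∘ liftLits-conj i C .to)

liftClause∈Aug : {A : Set} {S : List (Clause A)} {c : Clause A} → c ∈ S → liftClause c ∈ Aug S
liftClause∈Aug c∈S = ∈-++⁺ˡ (∈-map⁺ liftClause c∈S)

Aug-model : {A : Set} (S : List (Clause A)) (τ : Seq (Aug⁺ A)) →
  (∀ i c → c ∈ S → ClauseHolds τ i (liftClause c)) →
  (∀ i c {c′} → c′ ∈ S → c ∈ augExtra c′ → ClauseHolds τ i c) →
  IsModel τ (Aug S)
Aug-model S τ lifted extra i c c∈Aug with ∈-++⁻ (map liftClause S) c∈Aug
... | inj₁ c∈lifted with ∈-map⁻ liftClause c∈lifted
...   | c′ , c′∈S , refl = lifted i c′ c′∈S
Aug-model S τ lifted extra i c c∈Aug | inj₂ c∈extra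
  with find (∈-concatMap⁻ augExtra {xs = S} c∈extra)
...   | c′ , c′∈S , c∈augExtra = extra i c c′∈S c∈augExtra

restrict-model : {A : Set} (S : List (Clause A)) (τ : Seq (Aug⁺ A)) →
  IsModel τ (Aug S) → IsModel (restrict τ) S
restrict-model S τ τ⊨Aug i c c∈S =
  liftClause-holds τ i c .to (τ⊨Aug i (liftClause c) (liftClause∈Aug c∈S))

module Extension (em : ExcludedMiddle 0ℓ) {A : Set} where

  extend : Seq A → Seq (Aug⁺ A)
  extend σ i (inj₁ a) = σ i a
  extend σ i (inj₂ l) = does (em {Outstanding σ i l})

  extend-w : ∀ σ i l → LitHolds (extend σ) i (w l) ⇔ Outstanding σ i l
  extend-w σ i l with em {Outstanding σ i l}
  ... | yes outstanding = mk⇔ (λ _ → outstanding) (λ _ → refl)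
  ... | no ¬outstanding = mk⇔ (λ ()) (λ outstanding → contradiction outstanding ¬outstanding)

  module _ (σ : Seq A) where

    now-or-outstanding⇒l∨wₗ : ∀ i l →
      LitHolds σ i l ⊎ Outstanding σ i l → DisjHolds (extend σ) i (liftLit l ∷ w l ∷ [])
    now-or-outstanding⇒l∨wₗ i l (inj₁ now)         = here (liftLit-holds (extend σ) i l .from now)
    now-or-outstanding⇒l∨wₗ i l (inj₂ outstanding) = there (here (extend-w σ i l .from outstanding))

    sometime⇒¬C∨l∨wₗ : ∀ i C l → ClauseHolds σ i (sometime C l) →
      DisjHolds (extend σ) i (negConj (liftLits C) ++ (liftLit l ∷ w l ∷ []))
    sometime⇒¬C∨l∨wₗ i C l C⇒◇l with conj-or-negConj σ i C
    ... | inj₂ ¬C rewrite negConj-liftLits C =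
      Any.++⁺ˡ (liftLits-disj (extend σ) i (negConj C) .from ¬C)
    ... | inj₁ C-holds =
      Any.++⁺ʳ (negConj (liftLits C))
        (now-or-outstanding⇒l∨wₗ i l (eventually⇒now-or-outstanding σ i l (C⇒◇l C-holds)))

    module _ (S : List (Clause A)) (σ⊨S : IsModel σ S) where

      augExtra-holds : ∀ i c {c′} → c′ ∈ S → c ∈ augExtra c′ → ClauseHolds (extend σ) i c
      augExtra-holds i _ {sometime C l} _ (here refl) (wₗ ∷ []) =
        now-or-outstanding⇒l∨wₗ (suc i) l
          (eventually⇒now-or-outstanding σ (suc i) l
            (outstanding⇒eventually-next σ i l (extend-w σ i l .to wₗ)))
      augExtra-holds i _ {sometime C l} c′∈S (there (here refl)) refl =
        sometime⇒¬C∨l∨wₗ 0 C l (σ⊨S 0 (sometime C l) c′∈S)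
      augExtra-holds i _ {sometime C l} c′∈S (there (there (here refl))) [] =
        sometime⇒¬C∨l∨wₗ (suc i) C l (σ⊨S (suc i) (sometime C l) c′∈S)

      extend-model : IsModel (extend σ) (Aug S)
      extend-model = Aug-model S (extend σ)
        (λ i c c∈S → liftClause-holds (extend σ) i c .from (σ⊨S i c c∈S))
        augExtra-holds

      extend-normal : IsNormalModel S (extend σ)
      extend-normal = extend-model , λ l _ i →
        mk⇔ (liftLit-outstanding (extend σ) i l .from ∘ extend-w σ i l .to)
            (extend-w σ i l .from ∘ liftLit-outstanding (extend σ) i l .to)

lemma5 : ExcludedMiddle 0ℓ → {A : Set} → (S : List (Clause A)) →
    WellBehaved S × (Satisfiable (Aug S) ⇔ Satisfiable S)
lemma5 em S = well-behaved , mk⇔ restrict-sat extend-sat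
  where
  open Extension em

  restrict-sat : Satisfiable (Aug S) → Satisfiable S
  restrict-sat (τ , τ⊨Aug) = restrict τ , restrict-model S τ τ⊨Aug

  extend-sat : Satisfiable S → Satisfiable (Aug S)
  extend-sat (σ , σ⊨S) = extend σ , extend-model σ S σ⊨S

  well-behaved : WellBehaved S
  well-behaved with em {Satisfiable S}
  ... | yes (σ , σ⊨S) = inj₂ (extend σ , extend-normal σ S σ⊨S)
  ... | no unsat      = inj₁ (unsat ∘ restrict-sat)
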